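{- Let $G$ be a graph with $n$ vertices and clique number $\omega(G)$. Then $\operatorname{lcc}(G)+\omega(G)\leq n+1$.
   Context: All graphs are finite, simple and undirected; $\omega(G)$ is the maximum size of a clique of $G$. A clique of $G$ is a set of pairwise adjacent vertices. A clique covering of $E(G)$ is a family $\mathcal{C}$ of cliques of $G$ such that every edge of $G$ lies in at least one member of $\mathcal{C}$. For a vertex $v$, its valency $val_{\mathcal{C}}(v)$ is the number of cliques in $\mathcal{C}$ containing $v$. The local clique cover number $\operatorname{lcc}(G)$ is the smallest integer $k$ such that there is a clique covering $\mathcal{C}$ of $E(G)$ with $val_{\mathcal{C}}(v)\le k$ for every vertex $v$ of $G$. -}

module Defs where

open import Data.Nat using (ℕ; _≤_; _≥_)
open import Data.Bool using (Bool; true; false)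
open import Data.Fin using (Fin)
open import Data.Fin.Subset using (Subset; _∈_; ∣_∣)
open import Data.Fin.Subset.Properties using (_∈?_)
open import Data.List using (List; length; filter)
open import Data.List.Membership.Propositional renaming (_∈_ to _∈ₗ_)
open import Data.Product using (Σ; _×_; ∃; ∃-syntax)
open import Relation.Binary.PropositionalEquality using (_≡_; _≢_)

record Graph (n : ℕ) : Set where
  field
    adj     : Fin n → Fin n → Bool
    symm    : ∀ u v → adj u v ≡ adj v u
    irrefl  : ∀ v → adj v v ≡ false
open Graph public

IsClique : ∀ {n} → Graph n → Subset n → Set
IsClique G S = ∀ u v → u ∈ S → v ∈ S → u ≢ v → adj G u v ≡ true

IsCliqueNumber : ∀ {n} → Graph n → ℕ → Set
IsCliqueNumber G w =
  (∃[ S ] (IsClique G S × ∣ S ∣ ≡ w)) × (∀ S → IsClique G S → ∣ S ∣ ≤ w)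

IsCliqueCovering : ∀ {n} → Graph n → List (Subset n) → Set
IsCliqueCovering G 𝒞 =
  (∀ S → S ∈ₗ 𝒞 → IsClique G S) ×
  (∀ u v → adj G u v ≡ true → ∃[ S ] (S ∈ₗ 𝒞 × u ∈ S × v ∈ S))

valency : ∀ {n} → List (Subset n) → Fin n → ℕ
valency 𝒞 v = length (filter (v ∈?_) 𝒞)

HasLocalCover : ∀ {n} → Graph n → ℕ → Set
HasLocalCover G k =
  ∃[ 𝒞 ] (IsCliqueCovering G 𝒞 × (∀ v → valency 𝒞 v ≤ k))

IsLCC : ∀ {n} → Graph n → ℕ → Set
IsLCC G k = HasLocalCover G k × (∀ j → HasLocalCover G j → k ≤ j)

module Submission where

-- Let S be a clique with ∣ S ∣ = ω(G). Cover E(G) by S, by the star {x} ∪ (N(x) ∩ S) of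
-- every vertex x ∉ S, and by every edge with both ends outside S. A vertex of S lies in S
-- and in at most one star per vertex outside S; a vertex v ∉ S lies in its own star and in
-- at most one edge per other vertex outside S. So every valency is at most 1 + (n − ω(G)).

open import Defs
open import Level using (Level)
open import Data.Bool using (true; if_then_else_)
import Data.Bool.Properties as Bool
open import Data.Fin using (Fin; zero; suc; _≟_; _≤?_; _<?_)
import Data.Fin as Fin
import Data.Fin.Properties as Finₚ
open import Data.Fin.Subset using (Subset; inside; outside; _∈_; _∉_; ∁; ∣_∣)
open import Data.Fin.Subset.Properties using (_∈?_; ∣∁p∣≡n∸∣p∣; ∣p∣≤n; x∈p⇒x∉∁p; x∉p⇒x∈∁p)
open import Data.List using (List; []; _∷_; _++_; concat; tabulate)
open import Data.List.Membership.Propositional using () renaming (_∈_ to _∈ₗ_)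
open import Data.List.Membership.Propositional.Properties using (∈-tabulate⁺; ∈-tabulate⁻; ∈-concat⁺′; ∈-concat⁻′)
open import Data.List.Relation.Unary.Any using (here; there)
open import Data.Nat using (ℕ; zero; suc; _+_; _*_; _≤_; z≤n; s≤s)
open import Data.Nat.Properties
  using ( ≤-refl; ≤-trans; ≤-reflexive; +-mono-≤; +-monoˡ-≤; m≤n⇒m≤1+n; <⇒≱; ≰⇒>; m∸n+n≡m
        ; +-assoc; +-identityʳ; *-identityˡ; *-distribʳ-+; +-*-semiring; module ≤-Reasoning)
open import Data.Product using (_×_; _,_; proj₂; ∃-syntax)
open import Data.Sum using (_⊎_; inj₁; inj₂)
open import Data.Vec using ([]; _∷_)
import Data.Vec as Vec
open import Data.Vec.Properties using (lookup⇒[]=; []=⇒lookup; lookup∘tabulate)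
open import Function using (_∘_)
open import Relation.Binary.PropositionalEquality using (_≡_; _≢_; refl; sym; trans; cong; cong₂; module ≡-Reasoning)
open import Relation.Nullary using (¬_; Dec; yes; no; does; _×-dec_; _⊎-dec_; contradiction)
open import Relation.Nullary.Decidable using (dec-true)
open import Relation.Unary using (Pred; Decidable)
open import Algebra.Properties.Semiring.Sum +-*-semiring
  using (sum; sum-syntax; sum-cong-≗; sum-replicate-zero; ∑-distrib-+; ∑-comm; *-distribˡ-sum)

private
  variable
    a b c : Level
    A : Set a
    B : Set b
    C : Set c

𝟙 : Dec A → ℕ
𝟙 A? = if does A? then 1 else 0

𝟙-mono : (A? : Dec A) (B? : Dec B) → (A → B) → 𝟙 A? ≤ 𝟙 B?
𝟙-mono (no _)  _       _   = z≤n
𝟙-mono (yes p) (yes _) _   = ≤-refl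
𝟙-mono (yes p) (no ¬q) A→B = contradiction (A→B p) ¬q

𝟙-⊎ : (A? : Dec A) (B? : Dec B) (C? : Dec C) → (A → B ⊎ C) → 𝟙 A? ≤ 𝟙 B? + 𝟙 C?
𝟙-⊎ (no _)  _       _       _     = z≤n
𝟙-⊎ (yes _) (yes _) _       _     = s≤s z≤n
𝟙-⊎ (yes _) (no _)  (yes _) _     = ≤-refl
𝟙-⊎ (yes p) (no ¬q) (no ¬r) A→B⊎C with A→B⊎C p
... | inj₁ q = contradiction q ¬q
... | inj₂ r = contradiction r ¬r

𝟙-exclusive : (A? : Dec A) (B? : Dec B) → (A → ¬ B) → (¬ A → B) → 𝟙 A? + 𝟙 B? ≡ 1
𝟙-exclusive (yes p) (yes q) A→¬B _   = contradiction q (A→¬B p)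
𝟙-exclusive (yes _) (no  _) _    _   = refl
𝟙-exclusive (no  _) (yes _) _    _   = refl
𝟙-exclusive (no ¬p) (no ¬q) _    ¬A→B = contradiction (¬A→B ¬p) ¬q

𝟙-× : (A? : Dec A) (B? : Dec B) → 𝟙 (A? ×-dec B?) ≡ 𝟙 A? * 𝟙 B?
𝟙-× (yes _) B? = sym (*-identityˡ (𝟙 B?))
𝟙-× (no _)  B? = refl

𝟙-×₃ : (A? : Dec A) (B? : Dec B) (C? : Dec C) → 𝟙 (A? ×-dec B? ×-dec C?) ≡ 𝟙 A? * (𝟙 B? * 𝟙 C?)
𝟙-×₃ A? B? C? = trans (𝟙-× A? (B? ×-dec C?)) (cong (𝟙 A? *_) (𝟙-× B? C?))

𝟙-≤+𝟙->≡1 : ∀ {n} (u v : Fin n) → 𝟙 (v ≤? u) + 𝟙 (u <? v) ≡ 1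
𝟙-≤+𝟙->≡1 u v = 𝟙-exclusive (v ≤? u) (u <? v) (λ v≤u u<v → <⇒≱ u<v v≤u) ≰⇒>

∑-mono-≤ : ∀ {n} {f g : Fin n → ℕ} → (∀ i → f i ≤ g i) → sum f ≤ sum g
∑-mono-≤ {zero}  f≤g = z≤n
∑-mono-≤ {suc n} f≤g = +-mono-≤ (f≤g zero) (∑-mono-≤ (f≤g ∘ suc))

∑-δ : ∀ {n} (x : Fin n) (c : ℕ) → ∑[ y < n ] (𝟙 (y ≟ x) * c) ≡ c
∑-δ {suc n} zero    c = trans (cong₂ _+_ (*-identityˡ c) (sum-replicate-zero n)) (+-identityʳ c)
∑-δ {suc n} (suc x) c = ∑-δ x c

∑∑-δ : ∀ {m n} (x : Fin m) (f : Fin n → ℕ) →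
  ∑[ x′ < m ] ∑[ y < n ] (𝟙 (x′ ≟ x) * f y) ≡ ∑[ y < n ] f y
∑∑-δ {m} {n} x f = begin
  ∑[ x′ < m ] ∑[ y < n ] (𝟙 (x′ ≟ x) * f y) ≡⟨ sum-cong-≗ (λ x′ → sym (*-distribˡ-sum (𝟙 (x′ ≟ x)) f)) ⟩
  ∑[ x′ < m ] (𝟙 (x′ ≟ x) * ∑[ y < n ] f y) ≡⟨ ∑-δ x (sum f) ⟩
  ∑[ y < n ] f y                            ∎
  where open ≡-Reasoning

∑-𝟙-∈ : ∀ {n} (p : Subset n) → ∑[ x < n ] 𝟙 (x ∈? p) ≡ ∣ p ∣
∑-𝟙-∈ []            = refl
∑-𝟙-∈ (inside  ∷ p) = cong suc (∑-𝟙-∈ p)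
∑-𝟙-∈ (outside ∷ p) = ∑-𝟙-∈ p

∣∁p∣+∣p∣≡n : ∀ {n} (p : Subset n) → ∣ ∁ p ∣ + ∣ p ∣ ≡ n
∣∁p∣+∣p∣≡n p = trans (cong (_+ ∣ p ∣) (∣∁p∣≡n∸∣p∣ p)) (m∸n+n≡m (∣p∣≤n p))

subset : ∀ {n ℓ} {P : Pred (Fin n) ℓ} → Decidable P → Subset n
subset P? = Vec.tabulate (does ∘ P?)

module _ {n ℓ} {P : Pred (Fin n) ℓ} (P? : Decidable P) where

  ∈-subset⁺ : ∀ {x} → P x → x ∈ subset P?
  ∈-subset⁺ {x} px = lookup⇒[]= x (subset P?) (trans (lookup∘tabulate (does ∘ P?) x) (dec-true (P? x) px))

  ∈-subset⁻ : ∀ {x} → x ∈ subset P? → P x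
  ∈-subset⁻ {x} x∈ with P? x | trans (sym (lookup∘tabulate (does ∘ P?) x)) ([]=⇒lookup x∈)
  ... | yes px | _ = px

module _ {n : ℕ} (v : Fin n) where

  valency-∷ : ∀ C 𝒞 → valency (C ∷ 𝒞) v ≡ 𝟙 (v ∈? C) + valency 𝒞 v
  valency-∷ C 𝒞 with v ∈? C
  ... | yes _ = refl
  ... | no  _ = refl

  valency-++ : ∀ 𝒞 𝒟 → valency (𝒞 ++ 𝒟) v ≡ valency 𝒞 v + valency 𝒟 v
  valency-++ []      𝒟 = refl
  valency-++ (C ∷ 𝒞) 𝒟 = begin
    valency (C ∷ 𝒞 ++ 𝒟) v                ≡⟨ valency-∷ C (𝒞 ++ 𝒟) ⟩
    𝟙 (v ∈? C) + valency (𝒞 ++ 𝒟) v       ≡⟨ cong (𝟙 (v ∈? C) +_) (valency-++ 𝒞 𝒟) ⟩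
    𝟙 (v ∈? C) + (valency 𝒞 v + valency 𝒟 v) ≡⟨ sym (+-assoc (𝟙 (v ∈? C)) _ _) ⟩
    (𝟙 (v ∈? C) + valency 𝒞 v) + valency 𝒟 v ≡⟨ cong (_+ valency 𝒟 v) (sym (valency-∷ C 𝒞)) ⟩
    valency (C ∷ 𝒞) v + valency 𝒟 v       ∎
    where open ≡-Reasoning

  valency-tabulate : ∀ {m} (f : Fin m → Subset n) → valency (tabulate f) v ≡ ∑[ i < m ] 𝟙 (v ∈? f i)
  valency-tabulate {zero}  f = refl
  valency-tabulate {suc m} f =
    trans (valency-∷ (f zero) (tabulate (f ∘ suc))) (cong (𝟙 (v ∈? f zero) +_) (valency-tabulate (f ∘ suc)))

  valency-concat-tabulate : ∀ {m} (g : Fin m → List (Subset n)) →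
    valency (concat (tabulate g)) v ≡ ∑[ i < m ] valency (g i) v
  valency-concat-tabulate {zero}  g = refl
  valency-concat-tabulate {suc m} g =
    trans (valency-++ (g zero) _) (cong (valency (g zero) v +_) (valency-concat-tabulate (g ∘ suc)))

module CoverFromClique {n} (G : Graph n) (S : Subset n) (S-clique : IsClique G S) where

  Edge : Fin n → Fin n → Set
  Edge u w = adj G u w ≡ true

  edge? : ∀ u w → Dec (Edge u w)
  edge? u w = adj G u w Bool.≟ true

  edge-sym : ∀ {u w} → Edge u w → Edge w u
  edge-sym {u} {w} e = trans (symm G w u) e

  edge⇒≢ : ∀ {u w} → Edge u w → u ≢ w
  edge⇒≢ {u} e refl with trans (sym e) (irrefl G u)
  ... | ()

  -- For x ≤ y outside S, block x x is the star of x and block x y (x < y) is the edge xy,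
  -- or just {x} when x ≁ y; all other blocks are empty.
  Active : Fin n → Fin n → Set
  Active x y = x ∈ ∁ S × y ∈ ∁ S × x Fin.≤ y

  Joins : Fin n → Fin n → Fin n → Set
  Joins x y z = z ≡ x ⊎ (z ≡ y × Edge x y) ⊎ (x ≡ y × z ∈ S × Edge x z)

  InBlock : Fin n → Fin n → Fin n → Set
  InBlock x y z = Active x y × Joins x y z

  inBlock? : ∀ x y z → Dec (InBlock x y z)
  inBlock? x y z =
    (x ∈? ∁ S ×-dec y ∈? ∁ S ×-dec x ≤? y) ×-dec
    (z ≟ x ⊎-dec (z ≟ y ×-dec edge? x y) ⊎-dec (x ≟ y ×-dec z ∈? S ×-dec edge? x z))

  block : Fin n → Fin n → Subset n
  block x y = subset (inBlock? x y)

  joins⇒edge : ∀ {x y u w} → Joins x y u → Joins x y w → u ≢ w → Edge u w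
  joins⇒edge (inj₁ refl)                 (inj₁ refl)                 u≢w = contradiction refl u≢w
  joins⇒edge (inj₁ refl)                 (inj₂ (inj₁ (refl , e)))    _   = e
  joins⇒edge (inj₁ refl)                 (inj₂ (inj₂ (_ , _ , e)))   _   = e
  joins⇒edge (inj₂ (inj₁ (refl , e)))    (inj₁ refl)                 _   = edge-sym e
  joins⇒edge (inj₂ (inj₁ (refl , _)))    (inj₂ (inj₁ (refl , _)))    u≢w = contradiction refl u≢w
  joins⇒edge (inj₂ (inj₁ (_ , e)))       (inj₂ (inj₂ (x≡y , _ , _))) _   = contradiction x≡y (edge⇒≢ e)
  joins⇒edge (inj₂ (inj₂ (_ , _ , e)))   (inj₁ refl)                 _   = edge-sym e
  joins⇒edge (inj₂ (inj₂ (x≡y , _ , _))) (inj₂ (inj₁ (_ , e)))       _   = contradiction x≡y (edge⇒≢ e)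
  joins⇒edge (inj₂ (inj₂ (_ , u∈S , _))) (inj₂ (inj₂ (_ , w∈S , _))) u≢w = S-clique _ _ u∈S w∈S u≢w

  block-isClique : ∀ x y → IsClique G (block x y)
  block-isClique x y u w u∈ w∈ =
    joins⇒edge (proj₂ (∈-subset⁻ (inBlock? x y) u∈)) (proj₂ (∈-subset⁻ (inBlock? x y) w∈))

  cover : List (Subset n)
  cover = S ∷ concat (tabulate λ x → tabulate (block x))

  block∈cover : ∀ x y → block x y ∈ₗ cover
  block∈cover x y = there (∈-concat⁺′ (∈-tabulate⁺ y) (∈-tabulate⁺ x))

  cover-isClique : ∀ C → C ∈ₗ cover → IsClique G C
  cover-isClique C (here refl) = S-clique
  cover-isClique C (there C∈) with ∈-concat⁻′ (tabulate λ x → tabulate (block x)) C∈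
  ... | _ , C∈row , row∈ with ∈-tabulate⁻ row∈
  ...   | x , refl with ∈-tabulate⁻ C∈row
  ...     | y , refl = block-isClique x y

  Covered : Fin n → Fin n → Set
  Covered u w = ∃[ C ] (C ∈ₗ cover × u ∈ C × w ∈ C)

  covered-sym : ∀ {u w} → Covered u w → Covered w u
  covered-sym (C , C∈ , u∈C , w∈C) = C , C∈ , w∈C , u∈C

  covered-outside-inside : ∀ {u w} → u ∉ S → w ∈ S → Edge u w → Covered u w
  covered-outside-inside {u} {w} u∉S w∈S e =
    block u u , block∈cover u u , ∈-subset⁺ (inBlock? u u) (active , inj₁ refl)
                                , ∈-subset⁺ (inBlock? u u) (active , inj₂ (inj₂ (refl , w∈S , e)))
    where
    active : Active u u
    active = x∉p⇒x∈∁p u∉S , x∉p⇒x∈∁p u∉S , Finₚ.≤-refl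

  covered-outside : ∀ {u w} → u ∉ S → w ∉ S → u Fin.≤ w → Edge u w → Covered u w
  covered-outside {u} {w} u∉S w∉S u≤w e =
    block u w , block∈cover u w , ∈-subset⁺ (inBlock? u w) (active , inj₁ refl)
                                , ∈-subset⁺ (inBlock? u w) (active , inj₂ (inj₁ (refl , e)))
    where
    active : Active u w
    active = x∉p⇒x∈∁p u∉S , x∉p⇒x∈∁p w∉S , u≤w

  covers : ∀ u w → Edge u w → Covered u w
  covers u w e with u ∈? S | w ∈? S
  ... | yes u∈S | yes w∈S = S , here refl , u∈S , w∈S
  ... | no  u∉S | yes w∈S = covered-outside-inside u∉S w∈S e
  ... | yes u∈S | no  w∉S = covered-sym (covered-outside-inside w∉S u∈S (edge-sym e))
  ... | no  u∉S | no  w∉S with Finₚ.≤-total u w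
  ...   | inj₁ u≤w = covered-outside u∉S w∉S u≤w e
  ...   | inj₂ w≤u = covered-sym (covered-outside w∉S u∉S w≤u (edge-sym e))

  cover-isCliqueCovering : IsCliqueCovering G cover
  cover-isCliqueCovering = cover-isClique , covers

  valency-cover : ∀ v → valency cover v ≡ 𝟙 (v ∈? S) + ∑[ x < n ] ∑[ y < n ] 𝟙 (v ∈? block x y)
  valency-cover v = trans (valency-∷ v S _) (cong (𝟙 (v ∈? S) +_)
    (trans (valency-concat-tabulate v (λ x → tabulate (block x))) (sum-cong-≗ λ x → valency-tabulate v (block x))))

  block-valency-inside : ∀ {v} → v ∈ S → ∀ x y →
    𝟙 (v ∈? block x y) ≤ 𝟙 (y ≟ x) * 𝟙 (x ∈? ∁ S)
  block-valency-inside {v} v∈S x y =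
    ≤-trans (𝟙-mono (v ∈? block x y) (y ≟ x ×-dec x ∈? ∁ S) (diagonal ∘ ∈-subset⁻ (inBlock? x y)))
            (≤-reflexive (𝟙-× (y ≟ x) (x ∈? ∁ S)))
    where
    diagonal : InBlock x y v → y ≡ x × x ∈ ∁ S
    diagonal ((x∈∁S , _    , _) , inj₁ refl)                 = contradiction x∈∁S (x∈p⇒x∉∁p v∈S)
    diagonal ((_    , y∈∁S , _) , inj₂ (inj₁ (refl , _)))    = contradiction y∈∁S (x∈p⇒x∉∁p v∈S)
    diagonal ((x∈∁S , _    , _) , inj₂ (inj₂ (x≡y , _ , _))) = sym x≡y , x∈∁S

  block-valency-outside : ∀ {v} → v ∉ S → ∀ x y →
    𝟙 (v ∈? block x y) ≤ 𝟙 (x ≟ v) * (𝟙 (v ≤? y) * 𝟙 (y ∈? ∁ S))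
                         + 𝟙 (y ≟ v) * (𝟙 (x <? v) * 𝟙 (x ∈? ∁ S))
  block-valency-outside {v} v∉S x y = begin
    𝟙 (v ∈? block x y)
      ≤⟨ 𝟙-⊎ (v ∈? block x y) (x ≟ v ×-dec v ≤? y ×-dec y ∈? ∁ S) (y ≟ v ×-dec x <? v ×-dec x ∈? ∁ S)
             (endpoint ∘ ∈-subset⁻ (inBlock? x y)) ⟩
    𝟙 (x ≟ v ×-dec v ≤? y ×-dec y ∈? ∁ S) + 𝟙 (y ≟ v ×-dec x <? v ×-dec x ∈? ∁ S)
      ≡⟨ cong₂ _+_ (𝟙-×₃ (x ≟ v) (v ≤? y) (y ∈? ∁ S)) (𝟙-×₃ (y ≟ v) (x <? v) (x ∈? ∁ S)) ⟩
    𝟙 (x ≟ v) * (𝟙 (v ≤? y) * 𝟙 (y ∈? ∁ S)) + 𝟙 (y ≟ v) * (𝟙 (x <? v) * 𝟙 (x ∈? ∁ S)) ∎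
    where
    open ≤-Reasoning
    endpoint : InBlock x y v → x ≡ v × v Fin.≤ y × y ∈ ∁ S ⊎ y ≡ v × x Fin.< v × x ∈ ∁ S
    endpoint ((_    , y∈∁S , x≤y) , inj₁ refl)                 = inj₁ (refl , x≤y , y∈∁S)
    endpoint ((x∈∁S , _    , x≤y) , inj₂ (inj₁ (refl , e)))    = inj₂ (refl , Finₚ.≤∧≢⇒< x≤y (edge⇒≢ e) , x∈∁S)
    endpoint (_                   , inj₂ (inj₂ (_ , v∈S , _))) = contradiction v∈S v∉S

  blocks-valency-inside : ∀ {v} → v ∈ S → ∑[ x < n ] ∑[ y < n ] 𝟙 (v ∈? block x y) ≤ ∣ ∁ S ∣
  blocks-valency-inside {v} v∈S = begin
    ∑[ x < n ] ∑[ y < n ] 𝟙 (v ∈? block x y)        ≤⟨ ∑-mono-≤ (λ x → ∑-mono-≤ (block-valency-inside v∈S x)) ⟩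
    ∑[ x < n ] ∑[ y < n ] (𝟙 (y ≟ x) * 𝟙 (x ∈? ∁ S)) ≡⟨ sum-cong-≗ (λ x → ∑-δ x (𝟙 (x ∈? ∁ S))) ⟩
    ∑[ x < n ] 𝟙 (x ∈? ∁ S)                         ≡⟨ ∑-𝟙-∈ (∁ S) ⟩
    ∣ ∁ S ∣                                          ∎
    where open ≤-Reasoning

  -- Each outside u is charged once: as the larger end of a block with smaller end v if
  -- v ≤ u, as the smaller end of a block with larger end v if u < v.
  blocks-valency-outside : ∀ {v} → v ∉ S → ∑[ x < n ] ∑[ y < n ] 𝟙 (v ∈? block x y) ≤ ∣ ∁ S ∣
  blocks-valency-outside {v} v∉S = begin
    ∑[ x < n ] ∑[ y < n ] 𝟙 (v ∈? block x y)
      ≤⟨ ∑-mono-≤ (λ x → ∑-mono-≤ (block-valency-outside v∉S x)) ⟩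
    ∑[ x < n ] ∑[ y < n ] (𝟙 (x ≟ v) * after y + 𝟙 (y ≟ v) * before x)
      ≡⟨ sum-cong-≗ (λ x → ∑-distrib-+ (λ y → 𝟙 (x ≟ v) * after y) (λ y → 𝟙 (y ≟ v) * before x)) ⟩
    ∑[ x < n ] (∑[ y < n ] (𝟙 (x ≟ v) * after y) + ∑[ y < n ] (𝟙 (y ≟ v) * before x))
      ≡⟨ ∑-distrib-+ (λ x → ∑[ y < n ] (𝟙 (x ≟ v) * after y)) (λ x → ∑[ y < n ] (𝟙 (y ≟ v) * before x)) ⟩
    ∑[ x < n ] ∑[ y < n ] (𝟙 (x ≟ v) * after y) + ∑[ x < n ] ∑[ y < n ] (𝟙 (y ≟ v) * before x)
      ≡⟨ cong₂ _+_ (∑∑-δ v after) (trans (∑-comm (λ x y → 𝟙 (y ≟ v) * before x)) (∑∑-δ v before)) ⟩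
    ∑[ u < n ] after u + ∑[ u < n ] before u
      ≡⟨ sym (∑-distrib-+ after before) ⟩
    ∑[ u < n ] (after u + before u)
      ≡⟨ sum-cong-≗ after+before ⟩
    ∑[ u < n ] 𝟙 (u ∈? ∁ S)
      ≡⟨ ∑-𝟙-∈ (∁ S) ⟩
    ∣ ∁ S ∣ ∎
    where
    open ≤-Reasoning
    after before : Fin n → ℕ
    after  u = 𝟙 (v ≤? u) * 𝟙 (u ∈? ∁ S)
    before u = 𝟙 (u <? v) * 𝟙 (u ∈? ∁ S)
    after+before : ∀ u → after u + before u ≡ 𝟙 (u ∈? ∁ S)
    after+before u = trans (sym (*-distribʳ-+ (𝟙 (u ∈? ∁ S)) (𝟙 (v ≤? u)) (𝟙 (u <? v))))
                           (trans (cong (_* 𝟙 (u ∈? ∁ S)) (𝟙-≤+𝟙->≡1 u v)) (*-identityˡ _))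

  valency-cover-≤ : ∀ v → valency cover v ≤ suc ∣ ∁ S ∣
  valency-cover-≤ v rewrite valency-cover v with v ∈? S
  ... | yes v∈S = s≤s (blocks-valency-inside v∈S)
  ... | no  v∉S = m≤n⇒m≤1+n (blocks-valency-outside v∉S)

  hasLocalCover : HasLocalCover G (suc ∣ ∁ S ∣)
  hasLocalCover = cover , cover-isCliqueCovering , valency-cover-≤

proposition6 : (n : ℕ) (G : Graph n) (k w : ℕ) →
    IsLCC G k → IsCliqueNumber G w → k + w ≤ suc n
proposition6 n G k w (_ , lcc-minimal) ((S , S-clique , ∣S∣≡w) , _) = begin
  k + w                 ≤⟨ +-monoˡ-≤ w (lcc-minimal _ (CoverFromClique.hasLocalCover G S S-clique)) ⟩
  suc ∣ ∁ S ∣ + w       ≡⟨ cong (λ m → suc (∣ ∁ S ∣ + m)) (sym ∣S∣≡w) ⟩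
  suc (∣ ∁ S ∣ + ∣ S ∣) ≡⟨ cong suc (∣∁p∣+∣p∣≡n S) ⟩
  suc n                 ∎
  where open ≤-Reasoning
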